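{- Let $\sigma:G\to\tilde G$ be a multicovering projection and $k\ge 2$ an integer. Let $(\tilde D,\tilde\varphi)$ be a $k$-flow of $\tilde G$, let $D$ be the lifting of $\tilde D$, and let $\varphi$ be the integer-valued function on $E(G)$ defined by $\varphi(e)=\tilde\varphi(\sigma(e))$. Then $(D,\varphi)$ is a $k$-flow of $G$.
   Context: Graphs are finite, undirected, with loops and parallel edges allowed; $E(v)$ denotes the set of edges incident with $v$. A homomorphism $\sigma:G\to\tilde G$ is a map $V(G)\cup E(G)\to V(\tilde G)\cup E(\tilde G)$ sending vertices to vertices, edges to edges, and the end-vertices of each edge $e$ onto the end-vertices of $\sigma(e)$; it is surjective if it is surjective on vertices and on edges. A surjective homomorphism $\sigma$ is a multicovering projection if there is a positive integer $\ell$ with $|\sigma^{ -1}(\tilde e)\cap E(v)|=\ell$ for every $\tilde v\in V(\tilde G)$, every $v\in\sigma^{ -1}(\tilde v)$ and every $\tilde e\in E(\tilde v)$. Given an orientation $\tilde D$ of $\tilde G$, its lifting is the orientation $D$ of $G$ in which an edge $e$ with ends $u,v$ is oriented from $u$ to $v$ precisely when $\sigma(e)$ is oriented from $\sigma(u)$ to $\sigma(v)$ in $\tilde D$. A $k$-flow of $G$ is a pair $(D,\varphi)$ with $D$ an orientation, $\varphi:E(G)\to\mathbb{Z}$, $|\varphi(e)|<k$ for all $e$, and for every vertex $v$ the sum of $\varphi$ over edges with tail $v$ equals the sum over edges with head $v$. -}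

module Defs where

open import Data.Nat using (ℕ; zero; suc; _≤_)
open import Data.Fin using (Fin; zero; suc; _≟_)
open import Data.Integer as ℤ using (ℤ; ∣_∣; 0ℤ)
open import Data.Bool using (Bool; true; false; if_then_else_; _∧_; _∨_)
open import Data.Product using (Σ; _×_; _,_; ∃)
open import Data.Sum using (_⊎_)
open import Relation.Nullary.Decidable using (⌊_⌋)
open import Relation.Binary.PropositionalEquality using (_≡_)
open import Function.Bundles using (_⇔_)
open import Data.Nat using (_<_)

-- A finite multigraph (loops and parallel edges allowed):
-- vertices Fin nV, edges Fin nE, edge e has (unordered) ends end₁ e, end₂ e.
record Graph : Set where
  field
    nV    : ℕ
    nE    : ℕ
    end₁  : Fin nE → Fin nV
    end₂  : Fin nE → Fin nV

open Graph public

Vtx : Graph → Set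
Vtx G = Fin (nV G)

Edg : Graph → Set
Edg G = Fin (nE G)

Incident : (G : Graph) → Edg G → Vtx G → Set
Incident G e v = end₁ G e ≡ v ⊎ end₂ G e ≡ v

incident? : (G : Graph) → Edg G → Vtx G → Bool
incident? G e v = ⌊ end₁ G e ≟ v ⌋ ∨ ⌊ end₂ G e ≟ v ⌋

Ends : (G : Graph) → Edg G → Vtx G → Vtx G → Set
Ends G e x y = (end₁ G e ≡ x × end₂ G e ≡ y) ⊎ (end₁ G e ≡ y × end₂ G e ≡ x)

record Hom (G H : Graph) : Set where
  field
    vmap  : Vtx G → Vtx H
    emap  : Edg G → Edg H
    ends-preserved : ∀ e → Ends H (emap e) (vmap (end₁ G e)) (vmap (end₂ G e))

open Hom public

Surjective : {A B : Set} → (A → B) → Set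
Surjective {A} {B} f = ∀ (b : B) → ∃ λ (a : A) → f a ≡ b

count : {m : ℕ} → (Fin m → Bool) → ℕ
count {zero}  p = 0
count {suc m} p = (if p zero then 1 else 0) Data.Nat.+ count (λ i → p (suc i))

fiberDeg : {G H : Graph} → Hom G H → Edg H → Vtx G → ℕ
fiberDeg {G} σ ẽ v = count (λ e → ⌊ emap σ e ≟ ẽ ⌋ ∧ incident? G e v)

record MulticoveringProjection {G H : Graph} (σ : Hom G H) : Set where
  field
    surjV : Surjective (vmap σ)
    surjE : Surjective (emap σ)
    ℓ     : ℕ
    ℓ-pos : 1 ≤ ℓ
    uniform : ∀ (ṽ : Vtx H) (v : Vtx G) → vmap σ v ≡ ṽ →
              ∀ (ẽ : Edg H) → Incident H ẽ ṽ → fiberDeg σ ẽ v ≡ ℓ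

Orientation : Graph → Set
Orientation G = Edg G → Bool

tail : (G : Graph) → Orientation G → Edg G → Vtx G
tail G D e = if D e then end₁ G e else end₂ G e

head : (G : Graph) → Orientation G → Edg G → Vtx G
head G D e = if D e then end₂ G e else end₁ G e

OrientedFrom : (G : Graph) → Orientation G → Edg G → Vtx G → Vtx G → Set
OrientedFrom G D e x y = tail G D e ≡ x × head G D e ≡ y

IsLifting : {G H : Graph} → Hom G H → Orientation H → Orientation G → Set
IsLifting {G} {H} σ D̃ D =
  ∀ (e : Edg G) (u v : Vtx G) → Ends G e u v →
    OrientedFrom G D e u v ⇔ OrientedFrom H D̃ (emap σ e) (vmap σ u) (vmap σ v)

sumE : {m : ℕ} → (Fin m → ℤ) → ℤ
sumE {zero}  f = 0ℤ
sumE {suc m} f = f zero ℤ.+ sumE (λ i → f (suc i))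

IsFlow : (G : Graph) → ℕ → Orientation G → (Edg G → ℤ) → Set
IsFlow G k D φ =
  (∀ e → ∣ φ e ∣ < k) ×
  (∀ (v : Vtx G) →
     sumE (λ e → if ⌊ tail G D e ≟ v ⌋ then φ e else 0ℤ)
       ≡ sumE (λ e → if ⌊ head G D e ≟ v ⌋ then φ e else 0ℤ))

{-# OPTIONS --safe #-}
-- Locally the projection identifies the edges at v with the edges at σ(v), each
-- ℓ times over, and the lifted orientation matches tails with tails and heads
-- with heads.  Hence both the outflow and the inflow of the lifted flow at v are
-- ℓ times the corresponding quantity at σ(v), and conservation in H transfers to G.
module Submission where

open import Defs
open import Data.Nat using (ℕ; _≤_)
open import Data.Integer using (ℤ)
open import Function using (_∘_)

open import Data.Bool using (Bool; true; false; if_then_else_; _∧_; _∨_)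
open import Data.Fin using (Fin; zero; suc; _≟_)
open import Data.Integer using (+_; 0ℤ; _+_; _*_)
import Data.Integer.Properties as ℤ
open import Data.Product using (_×_; _,_; proj₁; proj₂)
open import Data.Sum using (_⊎_; inj₁; inj₂)
open import Function.Bundles using (Equivalence; mk⇔)
open import Relation.Nullary using (Dec; ¬_; yes; no; contradiction)
open import Relation.Nullary.Decidable using (⌊_⌋; does; _⊎-dec_; _×-dec_; isYes≗does; does-⇔)
open import Relation.Binary.PropositionalEquality
open ≡-Reasoning

open import Algebra.Properties.Semiring.Sum ℤ.+-*-semiring
  using (sum; sum-cong-≗; ∑-comm; *-distribˡ-sum)

if-∧ : {A : Set} (a b : Bool) (x y : A) →
       (if a ∧ b then x else y) ≡ (if a then (if b then x else y) else y)
if-∧ true  b x y = refl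
if-∧ false b x y = refl

sumE-cong : ∀ {m} {f g : Fin m → ℤ} → (∀ i → f i ≡ g i) → sumE f ≡ sumE g
sumE-cong {ℕ.zero}  f≗g = refl
sumE-cong {ℕ.suc m} f≗g = cong₂ _+_ (f≗g zero) (sumE-cong (f≗g ∘ suc))

sumE≡sum : ∀ {m} (f : Fin m → ℤ) → sumE f ≡ sum f
sumE≡sum {ℕ.zero}  f = refl
sumE≡sum {ℕ.suc m} f = cong (_+_ (f zero)) (sumE≡sum (f ∘ suc))

sumE-comm : ∀ {m n} (f : Fin m → Fin n → ℤ) →
            sumE (λ i → sumE (f i)) ≡ sumE (λ j → sumE (λ i → f i j))
sumE-comm f = begin
  sumE (λ i → sumE (f i))              ≡⟨ sumE≡sum (λ i → sumE (f i)) ⟩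
  sum (λ i → sumE (f i))               ≡⟨ sum-cong-≗ (λ i → sumE≡sum (f i)) ⟩
  sum (λ i → sum (f i))                ≡⟨ ∑-comm f ⟩
  sum (λ j → sum (λ i → f i j))        ≡⟨ sum-cong-≗ (λ j → sumE≡sum (λ i → f i j)) ⟨
  sum (λ j → sumE (λ i → f i j))       ≡⟨ sumE≡sum (λ j → sumE (λ i → f i j)) ⟨
  sumE (λ j → sumE (λ i → f i j))      ∎

sumE-*ˡ : ∀ {m} (x : ℤ) (f : Fin m → ℤ) → sumE (λ i → x * f i) ≡ x * sumE f
sumE-*ˡ x f = begin
  sumE (λ i → x * f i)  ≡⟨ sumE≡sum (λ i → x * f i) ⟩
  sum (λ i → x * f i)   ≡⟨ *-distribˡ-sum x f ⟨
  x * sum f             ≡⟨ cong (x *_) (sumE≡sum f) ⟨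
  x * sumE f            ∎

sumE-zero : ∀ m → sumE {m} (λ _ → 0ℤ) ≡ 0ℤ
sumE-zero ℕ.zero    = refl
sumE-zero (ℕ.suc m) = trans (ℤ.+-identityˡ _) (sumE-zero m)

sumE-δ : ∀ {n} (a : Fin n) (f : Fin n → ℤ) →
         sumE (λ j → if ⌊ a ≟ j ⌋ then f j else 0ℤ) ≡ f a
sumE-δ {ℕ.suc n} zero    f = trans (cong (_+_ (f zero)) (sumE-zero n)) (ℤ.+-identityʳ (f zero))
sumE-δ {ℕ.suc n} (suc a) f = begin
  0ℤ + sumE (λ j → if ⌊ suc a ≟ suc j ⌋ then f (suc j) else 0ℤ)
    ≡⟨ ℤ.+-identityˡ _ ⟩
  sumE (λ j → if ⌊ suc a ≟ suc j ⌋ then f (suc j) else 0ℤ)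
    ≡⟨ sumE-cong (λ j → cong (λ b → if b then f (suc j) else 0ℤ) (suc≟suc j)) ⟩
  sumE (λ j → if ⌊ a ≟ j ⌋ then f (suc j) else 0ℤ)
    ≡⟨ sumE-δ a (f ∘ suc) ⟩
  f (suc a) ∎
  where
  suc≟suc : ∀ j → ⌊ suc a ≟ suc j ⌋ ≡ ⌊ a ≟ j ⌋
  suc≟suc j = trans (isYes≗does (suc a ≟ suc j)) (sym (isYes≗does (a ≟ j)))

sumE-indicator : ∀ {m} (p : Fin m → Bool) (x : ℤ) →
                 sumE (λ i → if p i then x else 0ℤ) ≡ + count p * x
sumE-indicator {ℕ.zero}  p x = refl
sumE-indicator {ℕ.suc m} p x with p zero
... | true  = trans (cong (_+_ x) (sumE-indicator (p ∘ suc) x))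
                    (sym (ℤ.suc-* (+ count (p ∘ suc)) x))
... | false = trans (ℤ.+-identityˡ _) (sumE-indicator (p ∘ suc) x)

Incident? : (K : Graph) (e : Edg K) (v : Vtx K) → Dec (Incident K e v)
Incident? K e v = (end₁ K e ≟ v) ⊎-dec (end₂ K e ≟ v)

incident?≡does : (K : Graph) (e : Edg K) (v : Vtx K) → incident? K e v ≡ does (Incident? K e v)
incident?≡does K e v = cong₂ _∨_ (isYes≗does (end₁ K e ≟ v)) (isYes≗does (end₂ K e ≟ v))

flowAt : (K : Graph) → (Edg K → Vtx K) → (Edg K → ℤ) → Vtx K → ℤ
flowAt K end φ v = sumE (λ e → if ⌊ end e ≟ v ⌋ then φ e else 0ℤ)

module _ (K : Graph) (D : Orientation K) (e : Edg K) where

  tail-incident : Incident K e (tail K D e)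
  tail-incident with D e
  ... | true  = inj₁ refl
  ... | false = inj₂ refl

  head-incident : Incident K e (head K D e)
  head-incident with D e
  ... | true  = inj₂ refl
  ... | false = inj₁ refl

  incident⇒tail⊎head : ∀ {v} → Incident K e v → tail K D e ≡ v ⊎ head K D e ≡ v
  incident⇒tail⊎head i with D e | i
  ... | true  | inj₁ p = inj₁ p
  ... | true  | inj₂ p = inj₂ p
  ... | false | inj₁ p = inj₂ p
  ... | false | inj₂ p = inj₁ p

  ends-tail-head : Ends K e (tail K D e) (head K D e)
  ends-tail-head with D e
  ... | true  = inj₁ (refl , refl)
  ... | false = inj₂ (refl , refl)

  ends-head-tail : Ends K e (head K D e) (tail K D e)
  ends-head-tail with D e
  ... | true  = inj₂ (refl , refl)
  ... | false = inj₁ (refl , refl)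

module Lifting {G H : Graph} {σ : Hom G H} {D̃ : Orientation H} {D : Orientation G}
               (lift : IsLifting σ D̃ D) (e : Edg G) where

  private
    t = tail G D e
    h = head G D e

  image-oriented : OrientedFrom H D̃ (emap σ e) (vmap σ t) (vmap σ h)
  image-oriented = Equivalence.to (lift e t h (ends-tail-head G D e)) (refl , refl)

  vmap-tail : vmap σ t ≡ tail H D̃ (emap σ e)
  vmap-tail = sym (proj₁ image-oriented)

  vmap-head : vmap σ h ≡ head H D̃ (emap σ e)
  vmap-head = sym (proj₂ image-oriented)

  -- An edge whose image is a loop is oriented both ways, so it is itself a loop.
  vmap-injective-on-ends : vmap σ t ≡ vmap σ h → t ≡ h
  vmap-injective-on-ends σt≡σh = proj₁ (Equivalence.from (lift e h t (ends-head-tail G D e))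
    (trans (proj₁ image-oriented) σt≡σh , trans (proj₂ image-oriented) (sym σt≡σh)))

module _ {G H : Graph} {σ : Hom G H} (mp : MulticoveringProjection σ) where

  open MulticoveringProjection mp

  sumE-fibre : ∀ (v : Vtx G) (g : Edg H → ℤ) →
               (∀ ẽ → ¬ Incident H ẽ (vmap σ v) → g ẽ ≡ 0ℤ) →
               sumE (λ e → if incident? G e v then g (emap σ e) else 0ℤ) ≡ + ℓ * sumE g
  sumE-fibre v g vanish = begin
    sumE (λ e → if incident? G e v then g (emap σ e) else 0ℤ)
      ≡⟨ sumE-cong (λ e → sumE-δ (emap σ e) (λ ẽ → if incident? G e v then g ẽ else 0ℤ)) ⟨
    sumE (λ e → sumE (λ ẽ → if ⌊ emap σ e ≟ ẽ ⌋ then (if incident? G e v then g ẽ else 0ℤ) else 0ℤ))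
      ≡⟨ sumE-cong (λ e → sumE-cong (λ ẽ → if-∧ ⌊ emap σ e ≟ ẽ ⌋ (incident? G e v) (g ẽ) 0ℤ)) ⟨
    sumE (λ e → sumE (λ ẽ → if ⌊ emap σ e ≟ ẽ ⌋ ∧ incident? G e v then g ẽ else 0ℤ))
      ≡⟨ sumE-comm (λ e ẽ → if ⌊ emap σ e ≟ ẽ ⌋ ∧ incident? G e v then g ẽ else 0ℤ) ⟩
    sumE (λ ẽ → sumE (λ e → if ⌊ emap σ e ≟ ẽ ⌋ ∧ incident? G e v then g ẽ else 0ℤ))
      ≡⟨ sumE-cong (λ ẽ → sumE-indicator (λ e → ⌊ emap σ e ≟ ẽ ⌋ ∧ incident? G e v) (g ẽ)) ⟩
    sumE (λ ẽ → + fiberDeg σ ẽ v * g ẽ)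
      ≡⟨ sumE-cong fiberDeg-weight ⟩
    sumE (λ ẽ → + ℓ * g ẽ)
      ≡⟨ sumE-*ˡ (+ ℓ) g ⟩
    + ℓ * sumE g ∎
    where
    fiberDeg-weight : ∀ ẽ → + fiberDeg σ ẽ v * g ẽ ≡ + ℓ * g ẽ
    fiberDeg-weight ẽ with Incident? H ẽ (vmap σ v)
    ... | yes i = cong (λ n → + n * g ẽ) (uniform (vmap σ v) v refl ẽ i)
    ... | no ¬i rewrite vanish ẽ ¬i
                      | ℤ.*-zeroʳ (+ fiberDeg σ ẽ v)
                      | ℤ.*-zeroʳ (+ ℓ) = refl

  flowAt-fibre : (end : Edg G → Vtx G) (end~ : Edg H → Vtx H) →
                 (∀ e → Incident G e (end e)) → (∀ ẽ → Incident H ẽ (end~ ẽ)) →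
                 (∀ e → vmap σ (end e) ≡ end~ (emap σ e)) →
                 (∀ e v → Incident G e v → vmap σ v ≡ vmap σ (end e) → v ≡ end e) →
                 ∀ (φ̃ : Edg H → ℤ) v →
                 flowAt G end (φ̃ ∘ emap σ) v ≡ + ℓ * flowAt H end~ φ̃ (vmap σ v)
  flowAt-fibre end end~ end-incident end~-incident vmap-end end-unique φ̃ v = begin
    flowAt G end (φ̃ ∘ emap σ) v
      ≡⟨ sumE-cong (λ e → cong (λ b → if b then φ̃ (emap σ e) else 0ℤ) (end≟v e)) ⟩
    sumE (λ e → if incident? G e v ∧ ⌊ end~ (emap σ e) ≟ vmap σ v ⌋ then φ̃ (emap σ e) else 0ℤ)
      ≡⟨ sumE-cong (λ e → if-∧ (incident? G e v) _ _ 0ℤ) ⟩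
    sumE (λ e → if incident? G e v then φ̃-at (emap σ e) else 0ℤ)
      ≡⟨ sumE-fibre v φ̃-at φ̃-at-vanish ⟩
    + ℓ * flowAt H end~ φ̃ (vmap σ v) ∎
    where
    φ̃-at : Edg H → ℤ
    φ̃-at ẽ = if ⌊ end~ ẽ ≟ vmap σ v ⌋ then φ̃ ẽ else 0ℤ

    φ̃-at-vanish : ∀ ẽ → ¬ Incident H ẽ (vmap σ v) → φ̃-at ẽ ≡ 0ℤ
    φ̃-at-vanish ẽ ¬i with end~ ẽ ≟ vmap σ v
    ... | yes p = contradiction (subst (Incident H ẽ) p (end~-incident ẽ)) ¬i
    ... | no _  = refl

    end≟v : ∀ e → ⌊ end e ≟ v ⌋ ≡ incident? G e v ∧ ⌊ end~ (emap σ e) ≟ vmap σ v ⌋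
    end≟v e = begin
      ⌊ end e ≟ v ⌋
        ≡⟨ isYes≗does (end e ≟ v) ⟩
      does (end e ≟ v)
        ≡⟨ does-⇔ (mk⇔ to from) (end e ≟ v) (Incident? G e v ×-dec (end~ (emap σ e) ≟ vmap σ v)) ⟩
      does (Incident? G e v) ∧ does (end~ (emap σ e) ≟ vmap σ v)
        ≡⟨ cong₂ _∧_ (incident?≡does G e v) (isYes≗does (end~ (emap σ e) ≟ vmap σ v)) ⟨
      incident? G e v ∧ ⌊ end~ (emap σ e) ≟ vmap σ v ⌋ ∎
      where
      to : end e ≡ v → Incident G e v × end~ (emap σ e) ≡ vmap σ v
      to refl = end-incident e , sym (vmap-end e)
      from : Incident G e v × end~ (emap σ e) ≡ vmap σ v → end e ≡ v
      from (i , p) = sym (end-unique e v i (trans (sym p) (sym (vmap-end e))))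

lemma3p1 : (G H : Graph) (σ : Hom G H) → MulticoveringProjection σ →
           (k : ℕ) → 2 ≤ k →
           (D̃ : Orientation H) (φ̃ : Edg H → ℤ) → IsFlow H k D̃ φ̃ →
           (D : Orientation G) → IsLifting σ D̃ D →
           IsFlow G k D (φ̃ ∘ emap σ)
lemma3p1 G H σ mp _ _ D̃ φ̃ (bounded , conserved) D lift = bounded ∘ emap σ , λ v → begin
  flowAt G (tail G D) (φ̃ ∘ emap σ) v
    ≡⟨ flowAt-fibre mp (tail G D) (tail H D̃) (tail-incident G D) (tail-incident H D̃)
                    vmap-tail tail-unique φ̃ v ⟩
  + ℓ * flowAt H (tail H D̃) φ̃ (vmap σ v)
    ≡⟨ cong (+ ℓ *_) (conserved (vmap σ v)) ⟩
  + ℓ * flowAt H (head H D̃) φ̃ (vmap σ v)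
    ≡⟨ flowAt-fibre mp (head G D) (head H D̃) (head-incident G D) (head-incident H D̃)
                    vmap-head head-unique φ̃ v ⟨
  flowAt G (head G D) (φ̃ ∘ emap σ) v ∎
  where
  open MulticoveringProjection mp using (ℓ)
  open Lifting {σ = σ} {D̃ = D̃} {D = D} lift

  tail-unique : ∀ e v → Incident G e v → vmap σ v ≡ vmap σ (tail G D e) → v ≡ tail G D e
  tail-unique e v i σv≡σt with incident⇒tail⊎head G D e i
  ... | inj₁ t≡v = sym t≡v
  ... | inj₂ refl = sym (vmap-injective-on-ends e (sym σv≡σt))

  head-unique : ∀ e v → Incident G e v → vmap σ v ≡ vmap σ (head G D e) → v ≡ head G D e
  head-unique e v i σv≡σh with incident⇒tail⊎head G D e i
  ... | inj₁ refl = vmap-injective-on-ends e σv≡σh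
  ... | inj₂ h≡v = sym h≡v
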